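{- Let $G$ be a graph, $v\in V(G)$, and let $G'$ be the graph obtained from $G$ by deleting $v$ and adding, for each pair $v_i,v_j$ of distinct neighbours of $v$, a new vertex $v_{ij}$ adjacent exactly to $v_i$ and $v_j$. Then for every positive integer $k$, $G$ has a minimal odd cycle transversal of size at most $k$ that excludes $v$ if and only if $G'$ has a minimal odd cycle transversal of size at most $k$.
   Context: An odd cycle transversal of a graph is a set of vertices whose deletion leaves a bipartite graph; it is minimal if no proper subset is an odd cycle transversal. -}

module Defs where

open import Data.Bool using (Bool; true; false; T; _∨_)
open import Data.Bool.Properties using (∨-comm)
open import Data.Nat using (ℕ)
open import Data.Fin using (Fin; _<_; _≟_)
open import Data.Product using (Σ; _×_; _,_; proj₁)
open import Data.Sum using (_⊎_; inj₁; inj₂)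
open import Data.List using (List)
open import Data.List.Membership.Propositional using (_∉_)
open import Data.List.Relation.Binary.Subset.Propositional using (_⊆_)
open import Data.List.Relation.Unary.Unique.Propositional using (Unique)
open import Relation.Nullary using (¬_; ⌊_⌋)
open import Relation.Nullary.Decidable using (False)
open import Relation.Binary.PropositionalEquality using (_≡_; _≢_; refl)

-- A (simple, loopless, undirected) graph on vertex type V, with decidable
-- (Bool-valued) adjacency, so that adjacency is proof-irrelevant.
record Graph (V : Set) : Set where
  field
    adj        : V → V → Bool
    adj-sym    : ∀ a b → adj a b ≡ adj b a
    adj-irrefl : ∀ a → adj a a ≡ false

  Adj : V → V → Set
  Adj a b = T (adj a b)

open Graph public

induced : {V : Set} → Graph V → (P : V → Set) → Graph (Σ V P)
induced G P = record
  { adj        = λ a b → adj G (proj₁ a) (proj₁ b)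
  ; adj-sym    = λ a b → adj-sym G (proj₁ a) (proj₁ b)
  ; adj-irrefl = λ a → adj-irrefl G (proj₁ a)
  }

_─_ : {V : Set} → Graph V → (S : List V) → Graph (Σ V (λ u → u ∉ S))
G ─ S = induced G (λ u → u ∉ S)

Bipartite : {V : Set} → Graph V → Set
Bipartite {V} G = Σ (V → Bool) (λ c → ∀ a b → Adj G a b → c a ≢ c b)

-- Vertex sets are duplicate-free lists; the size is the length.
-- S is an odd cycle transversal: deleting S leaves a bipartite graph.
IsOCT : {V : Set} → Graph V → List V → Set
IsOCT G S = Bipartite (G ─ S)

IsMinimalOCT : {V : Set} → Graph V → List V → Set
IsMinimalOCT {V} G S =
  Unique S × IsOCT G S ×
  (∀ (T : List V) → Unique T → T ⊆ S → ¬ (S ⊆ T) → ¬ IsOCT G T)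

-- The graph G' obtained from G by deleting v and adding, for every pair
-- {i , j} of distinct neighbours of v (encoded with i < j), a new vertex
-- adjacent exactly to i and j.
OldVertex : (n : ℕ) → Fin n → Set
OldVertex n v = Σ (Fin n) (λ u → False (u ≟ v))

NewVertex : {n : ℕ} → Graph (Fin n) → Fin n → Set
NewVertex {n} G v = Σ (Fin n × Fin n) (λ { (i , j) → i < j × Adj G v i × Adj G v j })

V′ : {n : ℕ} → Graph (Fin n) → Fin n → Set
V′ {n} G v = OldVertex n v ⊎ NewVertex G v

private
  adj′ : {n : ℕ} (G : Graph (Fin n)) (v : Fin n) → V′ G v → V′ G v → Bool
  adj′ G v (inj₁ (a , _)) (inj₁ (b , _)) = adj G a b
  adj′ G v (inj₁ (a , _)) (inj₂ ((i , j) , _)) = ⌊ a ≟ i ⌋ ∨ ⌊ a ≟ j ⌋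
  adj′ G v (inj₂ ((i , j) , _)) (inj₁ (a , _)) = ⌊ a ≟ i ⌋ ∨ ⌊ a ≟ j ⌋
  adj′ G v (inj₂ _) (inj₂ _) = false

  adj′-sym : {n : ℕ} (G : Graph (Fin n)) (v : Fin n) → ∀ a b → adj′ G v a b ≡ adj′ G v b a
  adj′-sym G v (inj₁ (a , _)) (inj₁ (b , _)) = adj-sym G a b
  adj′-sym G v (inj₁ _) (inj₂ _) = refl
  adj′-sym G v (inj₂ _) (inj₁ _) = refl
  adj′-sym G v (inj₂ _) (inj₂ _) = refl

  adj′-irrefl : {n : ℕ} (G : Graph (Fin n)) (v : Fin n) → ∀ a → adj′ G v a a ≡ false
  adj′-irrefl G v (inj₁ (a , _)) = adj-irrefl G a
  adj′-irrefl G v (inj₂ _) = refl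

G′ : {n : ℕ} (G : Graph (Fin n)) (v : Fin n) → Graph (V′ G v)
G′ G v = record { adj = adj′ G v ; adj-sym = adj′-sym G v ; adj-irrefl = adj′-irrefl G v }

-- Project G′ back onto G by sending an old vertex to itself and the new vertex v_ij to i.
-- If S′ is an odd cycle transversal of G′, a proper 2-colouring of G′ − S′ colours
-- G − v − π(S′); any two neighbours i, j of v outside π(S′) have the common neighbour
-- v_ij in G′ − S′, so they get the same colour and v can take the opposite one. Hence π(S′)
-- is an odd cycle transversal of G avoiding v, no larger than S′, and it contains a minimal
-- one. Conversely, for an odd cycle transversal S of G avoiding v, colouring every v_ij like v
-- shows that S is one of G′; it is minimal there because a smaller one would project to a
-- smaller one of G.
module Submission where

open import Defs
open import Data.Bool using (Bool; false; T; not)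
open import Data.Bool.Properties using (T-irrelevant; T-∨; not-¬; ¬-not) renaming (_≟_ to _≟ᴮ_)
open import Data.Nat using (ℕ; zero; suc; _≤_; s≤s⁻¹)
open import Data.Nat.Properties using (≤-refl; ≤-trans; ≤-reflexive)
open import Data.Fin using (Fin; _<_; _≟_)
open import Data.Fin.Properties using (<-cmp; all?; any?)
open import Data.Fin.Subset.Properties using (anySubset?)
open import Data.Vec using (lookup; tabulate)
open import Data.Vec.Properties using (lookup∘tabulate)
open import Data.Product using (Σ; ∃; ∃₂; ∃-syntax; _×_; _,_; proj₁)
open import Data.Sum using (_⊎_; inj₁; inj₂)
import Data.Sum as Sum
open import Data.Empty using (⊥-elim)
open import Data.List using (List; []; _∷_; length; map; filter; deduplicate)
open import Data.List.Properties using (length-map; length-filter; filter-notAll; length-deduplicate)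
open import Data.List.Membership.Propositional using (_∈_; _∉_; find; mapWith∈)
open import Data.List.Membership.Propositional.Properties
  using (∈-map⁺; ∈-map⁻; ∈-filter⁺; ∈-filter⁻; ∈-deduplicate⁺; ∈-deduplicate⁻; map-mapWith∈; mapWith∈-id)
open import Data.List.Relation.Unary.Any using (Any; here; there)
import Data.List.Relation.Unary.Any as Any
import Data.List.Relation.Unary.Any.Properties as Any
import Data.List.Relation.Unary.All as All
open import Data.List.Relation.Unary.All.Properties.Core using (¬All⇒Any¬)
open import Data.List.Relation.Binary.Subset.Propositional using (_⊆_)
open import Data.List.Relation.Unary.Unique.Propositional using (Unique)
import Data.List.Relation.Unary.Unique.Propositional.Properties as Unique
open import Function using (_∘_; id)
open import Function.Bundles using (_⇔_; mk⇔; Equivalence)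
open import Relation.Nullary using (¬_; Dec; yes; no; ¬?; ⌊_⌋)
open import Relation.Nullary.Decidable
  using (False; fromWitness; toWitness; fromWitnessFalse; toWitnessFalse; T?; _×-dec_; _→-dec_)
import Relation.Nullary.Decidable as Dec
open import Relation.Binary.Definitions using (DecidableEquality; tri<; tri≈; tri>)
open import Relation.Binary.PropositionalEquality using (_≡_; _≢_; refl; sym; trans; cong; subst)

private
  variable
    V : Set
    x : V
    S R : List V

ProperOn : Graph V → (V → Set) → (V → Bool) → Set
ProperOn G P c = ∀ a b → P a → P b → Adj G a b → c a ≢ c b

Monochromatic : (V → Bool) → (V → Set) → Set
Monochromatic c P = ∀ a b → P a → P b → c a ≡ c b

-- IsOCT with the colouring defined on all of V, which avoids the subtypes of G ─ S.
IsOCTᶜ : Graph V → List V → Set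
IsOCTᶜ {V} G S = Σ (V → Bool) (ProperOn G (_∉ S))

IsOCTᶜ⇒IsOCT : (G : Graph V) → IsOCTᶜ G S → IsOCT G S
IsOCTᶜ⇒IsOCT G (c , proper) = c ∘ proj₁ , λ (a , a∉S) (b , b∉S) → proper a b a∉S b∉S

IsOCTᶜ-⊆ : (G : Graph V) → S ⊆ R → IsOCTᶜ G S → IsOCTᶜ G R
IsOCTᶜ-⊆ G S⊆R (c , proper) = c , λ a b a∉R b∉R → proper a b (a∉R ∘ S⊆R) (b∉R ∘ S⊆R)

module _ {V : Set} (_≟ⱽ_ : DecidableEquality V) where
  open import Data.List.Membership.DecPropositional _≟ⱽ_ using (_∈?_)

  IsOCT⇒IsOCTᶜ : (G : Graph V) (S : List V) → IsOCT G S → IsOCTᶜ G S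
  IsOCT⇒IsOCTᶜ G S (c , proper) =
    (λ a → colourAt a (a ∈? S)) , λ a b → colourAt-proper a b (a ∈? S) (b ∈? S)
    where
    colourAt : (a : V) → Dec (a ∈ S) → Bool
    colourAt a (yes _)  = false
    colourAt a (no a∉S) = c (a , a∉S)

    colourAt-proper : ∀ a b a∈?S b∈?S → a ∉ S → b ∉ S → Adj G a b →
      colourAt a a∈?S ≢ colourAt b b∈?S
    colourAt-proper a b (yes a∈S) _         a∉S _   _  = ⊥-elim (a∉S a∈S)
    colourAt-proper a b _         (yes b∈S) _   b∉S _  = ⊥-elim (b∉S b∈S)
    colourAt-proper a b (no a∉S)  (no b∉S)  _   _   ab = proper (a , a∉S) (b , b∉S) ab

  remove : V → List V → List V
  remove x = filter (λ y → ¬? (y ≟ⱽ x))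

  remove-⊆ : remove x S ⊆ S
  remove-⊆ = proj₁ ∘ ∈-filter⁻ _

  length-remove-< : x ∈ S → suc (length (remove x S)) ≤ length S
  length-remove-< {S = S} x∈S = filter-notAll _ S (Any.map (λ { refl x≢x → x≢x refl }) x∈S)

  ⊆-remove : R ⊆ S → x ∉ R → R ⊆ remove x S
  ⊆-remove R⊆S x∉R y∈R = ∈-filter⁺ _ (R⊆S y∈R) λ { refl → x∉R y∈R }

  irreducible⇒IsMinimalOCT : (G : Graph V) → Unique S → IsOCTᶜ G S →
    ¬ Any (λ x → IsOCTᶜ G (remove x S)) S → IsMinimalOCT G S
  irreducible⇒IsMinimalOCT {S} G unique oct irreducible = unique , IsOCTᶜ⇒IsOCT G oct , minimal
    where
    minimal : ∀ R → Unique R → R ⊆ S → ¬ (S ⊆ R) → ¬ IsOCT G R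
    minimal R _ R⊆S S⊈R octR with All.all? (_∈? R) S
    ... | yes S⊆R = S⊈R (All.lookup S⊆R)
    ... | no ¬S⊆R = irreducible (Any.map (λ x∉R → IsOCTᶜ-⊆ G (⊆-remove R⊆S x∉R) (IsOCT⇒IsOCTᶜ G R octR))
                                         (¬All⇒Any¬ (_∈? R) S ¬S⊆R))

module _ {n : ℕ} (G : Graph (Fin n)) where
  open import Data.List.Membership.DecPropositional (_≟_ {n}) using (_∈?_)

  isOCTᶜ? : (S : List (Fin n)) → Dec (IsOCTᶜ G S)
  isOCTᶜ? S = Dec.map′ (λ (s , proper) → lookup s , proper) fromColouring
    (anySubset? λ s → all? λ a → all? λ b →
       ¬? (a ∈? S) →-dec ¬? (b ∈? S) →-dec T? (adj G a b) →-dec ¬? (lookup s a ≟ᴮ lookup s b))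
    where
    fromColouring : IsOCTᶜ G S → ∃ λ s → ProperOn G (_∉ S) (lookup s)
    fromColouring (c , proper) = tabulate c , λ a b a∉S b∉S ab eq →
      proper a b a∉S b∉S ab (trans (sym (lookup∘tabulate c a)) (trans eq (lookup∘tabulate c b)))

  MinimalOCTWithin : List (Fin n) → Set
  MinimalOCTWithin S = ∃[ S* ] (IsMinimalOCT G S* × S* ⊆ S × length S* ≤ length S)

  minimalOCTWithin : (S : List (Fin n)) → Unique S → IsOCTᶜ G S → MinimalOCTWithin S
  minimalOCTWithin S = search (length S) S ≤-refl
    where
    search : (bound : ℕ) (S : List (Fin n)) → length S ≤ bound → Unique S → IsOCTᶜ G S →
      MinimalOCTWithin S
    search zero [] _ unique oct = [] , irreducible⇒IsMinimalOCT _≟_ G unique oct (λ ()) , id , ≤-refl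
    search (suc bound) S |S|≤ unique oct with Any.any? (λ x → isOCTᶜ? (remove _≟_ x S)) S
    ... | no irreducible = S , irreducible⇒IsMinimalOCT _≟_ G unique oct irreducible , id , ≤-refl
    ... | yes removable =
      let x , x∈S , oct′ = find removable
          S* , minimal , S*⊆ , |S*|≤ = search bound (remove _≟_ x S)
            (s≤s⁻¹ (≤-trans (length-remove-< _≟_ x∈S) |S|≤)) (Unique.filter⁺ _ unique) oct′
      in  S* , minimal , remove-⊆ _≟_ ∘ S*⊆ , ≤-trans |S*|≤ (length-filter _ S)

  -- A vertex whose neighbours outside L are monochromatic can be coloured opposite to them.
  IsOCTᶜ-∷⁻ : (v : Fin n) (L : List (Fin n)) (c : Fin n → Bool) → ProperOn G (_∉ v ∷ L) c →
    Monochromatic c (λ u → Adj G v u × u ∉ L) → IsOCTᶜ G L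
  IsOCTᶜ-∷⁻ v L c proper mono =
    (λ a → recolour a (a ≟ v)) , λ a b → recolour-proper a b (a ≟ v) (b ≟ v)
    where
    colourOfV : Bool
    colourOfV with any? (λ u → T? (adj G v u) ×-dec ¬? (u ∈? L))
    ... | yes (u , _) = not (c u)
    ... | no _        = false

    colourOfV≢ : ∀ b → Adj G v b → b ∉ L → colourOfV ≢ c b
    colourOfV≢ b vb b∉L with any? (λ u → T? (adj G v u) ×-dec ¬? (u ∈? L))
    ... | yes (u , vu , u∉L) = λ eq → not-¬ (mono b u (vb , b∉L) (vu , u∉L)) (sym eq)
    ... | no none            = ⊥-elim (none (b , vb , b∉L))

    recolour : (a : Fin n) → Dec (a ≡ v) → Bool
    recolour a (yes _) = colourOfV
    recolour a (no _)  = c a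

    ∉-∷ : ∀ {a} → a ≢ v → a ∉ L → a ∉ v ∷ L
    ∉-∷ a≢v _   (here a≡v)  = a≢v a≡v
    ∉-∷ _   a∉L (there a∈L) = a∉L a∈L

    recolour-proper : ∀ a b a≟v b≟v → a ∉ L → b ∉ L → Adj G a b →
      recolour a a≟v ≢ recolour b b≟v
    recolour-proper a b (yes refl) (yes refl) _   _   vv = λ _ → subst T (adj-irrefl G v) vv
    recolour-proper a b (yes refl) (no _)     _   b∉L vb = colourOfV≢ b vb b∉L
    recolour-proper a b (no _)     (yes refl) a∉L _   av = colourOfV≢ a (subst T (adj-sym G a v) av) a∉L ∘ sym
    recolour-proper a b (no a≢v)   (no b≢v)   a∉L b∉L ab = proper a b (∉-∷ a≢v a∉L) (∉-∷ b≢v b∉L) ab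

module _ {n : ℕ} (G : Graph (Fin n)) (v : Fin n) where
  open import Data.List.Membership.DecPropositional (_≟_ {n}) using (_∈?_)
  open import Data.List.Relation.Unary.Unique.DecPropositional.Properties (_≟_ {n}) using (deduplicate-!)

  project : V′ G v → Fin n
  project (inj₁ (u , _))       = u
  project (inj₂ ((i , _) , _)) = i

  neighbour≢v : ∀ {u} → Adj G v u → u ≢ v
  neighbour≢v vu refl = subst T (adj-irrefl G v) vu

  project≢v : ∀ x → project x ≢ v
  project≢v (inj₁ (_ , u≢v))       = toWitnessFalse u≢v
  project≢v (inj₂ (_ , _ , vi , _)) = neighbour≢v vi

  old : (u : Fin n) → u ≢ v → V′ G v
  old u u≢v = inj₁ (u , fromWitnessFalse u≢v)

  old-irrelevant : ∀ {u} (p q : False (u ≟ v)) → _≡_ {A = V′ G v} (inj₁ (u , p)) (inj₁ (u , q))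
  old-irrelevant p q = cong (λ r → inj₁ (_ , r)) (T-irrelevant p q)

  Adj-old-new : ∀ {a i j} (p : False (a ≟ v)) (q : i < j × Adj G v i × Adj G v j) →
    Adj (G′ G v) (inj₁ (a , p)) (inj₂ ((i , j) , q)) ⇔ (a ≡ i ⊎ a ≡ j)
  Adj-old-new {a} {i} {j} _ _ = mk⇔
    (Sum.map toWitness toWitness ∘ Equivalence.to (T-∨ {⌊ a ≟ i ⌋} {⌊ a ≟ j ⌋}))
    (Equivalence.from (T-∨ {⌊ a ≟ i ⌋} {⌊ a ≟ j ⌋}) ∘ Sum.map fromWitness fromWitness)

  projectOCT : (S′ : List (V′ G v)) → IsOCT (G′ G v) S′ → IsOCTᶜ G (map project S′)
  projectOCT S′ (c′ , proper′) = IsOCTᶜ-∷⁻ G v L colour colour-proper colour-mono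
    where
    L : List (Fin n)
    L = map project S′

    colourAt : (u : Fin n) → Dec (u ≡ v) → Dec (u ∈ L) → Bool
    colourAt u (no u≢v) (no u∉L) = c′ (old u u≢v , u∉L ∘ ∈-map⁺ project)
    colourAt u _        _        = false

    colour : Fin n → Bool
    colour u = colourAt u (u ≟ v) (u ∈? L)

    colourAt-old : ∀ u u≟v u∈?L → u ≢ v → u ∉ L →
      ∃₂ λ p r → colourAt u u≟v u∈?L ≡ c′ (inj₁ (u , p) , r)
    colourAt-old u (yes u≡v) _         u≢v _   = ⊥-elim (u≢v u≡v)
    colourAt-old u _         (yes u∈L) _   u∉L = ⊥-elim (u∉L u∈L)
    colourAt-old u (no _)    (no _)    _   _   = _ , _ , refl

    colour-old : ∀ u → u ≢ v → u ∉ L → ∃₂ λ p r → colour u ≡ c′ (inj₁ (u , p) , r)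
    colour-old u = colourAt-old u (u ≟ v) (u ∈? L)

    colour-proper : ProperOn G (_∉ v ∷ L) colour
    colour-proper a b a∉ b∉ ab
      with colour-old a (a∉ ∘ here) (a∉ ∘ there) | colour-old b (b∉ ∘ here) (b∉ ∘ there)
    ... | _ , ra , ca | _ , rb , cb = λ eq → proper′ (_ , ra) (_ , rb) ab (trans (sym ca) (trans eq cb))

    -- i and j are both adjacent to v_ij, which survives since it projects to i ∉ L.
    colour-shared : ∀ {i j} → i < j → Adj G v i → Adj G v j → i ∉ L → j ∉ L → colour i ≡ colour j
    colour-shared {i} {j} i<j vi vj i∉L j∉L
      with colour-old i (neighbour≢v vi) i∉L | colour-old j (neighbour≢v vj) j∉L
    ... | p , ri , ci | q , rj , cj = trans (trans ci (¬-not i≁w)) (sym (trans cj (¬-not j≁w)))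
      where
      vij : i < j × Adj G v i × Adj G v j
      vij = i<j , vi , vj
      w : Σ (V′ G v) (_∉ S′)
      w = inj₂ ((i , j) , vij) , i∉L ∘ ∈-map⁺ project
      i≁w : c′ (inj₁ (i , p) , ri) ≢ c′ w
      i≁w = proper′ (_ , ri) w (Equivalence.from (Adj-old-new p vij) (inj₁ refl))
      j≁w : c′ (inj₁ (j , q) , rj) ≢ c′ w
      j≁w = proper′ (_ , rj) w (Equivalence.from (Adj-old-new q vij) (inj₂ refl))

    colour-mono : Monochromatic colour (λ u → Adj G v u × u ∉ L)
    colour-mono i j (vi , i∉L) (vj , j∉L) with <-cmp i j
    ... | tri< i<j _ _  = colour-shared i<j vi vj i∉L j∉L
    ... | tri≈ _ refl _ = refl
    ... | tri> _ _ j<i  = sym (colour-shared j<i vj vi j∉L i∉L)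

  projection : List (V′ G v) → List (Fin n)
  projection S′ = deduplicate _≟_ (map project S′)

  projection-unique : ∀ S′ → Unique (projection S′)
  projection-unique S′ = deduplicate-! (map project S′)

  ∈-projection⁻ : ∀ S′ {u} → u ∈ projection S′ → ∃[ x ] (x ∈ S′ × u ≡ project x)
  ∈-projection⁻ S′ u∈ = ∈-map⁻ project (∈-deduplicate⁻ _≟_ (map project S′) u∈)

  v∉projection : ∀ S′ → v ∉ projection S′
  v∉projection S′ v∈ with ∈-projection⁻ S′ v∈
  ... | x , _ , v≡x = project≢v x (sym v≡x)

  length-projection : ∀ S′ → length (projection S′) ≤ length S′
  length-projection S′ =
    ≤-trans (length-deduplicate _≟_ (map project S′)) (≤-reflexive (length-map project S′))

  projectionOCT : ∀ S′ → IsOCT (G′ G v) S′ → IsOCTᶜ G (projection S′)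
  projectionOCT S′ oct = IsOCTᶜ-⊆ G (∈-deduplicate⁺ _≟_) (projectOCT S′ oct)

  minimalOCT-within-projection : ∀ S′ → IsOCT (G′ G v) S′ →
    ∃[ S ] (IsMinimalOCT G S × v ∉ S × length S ≤ length S′)
  minimalOCT-within-projection S′ oct
    with minimalOCTWithin G (projection S′) (projection-unique S′) (projectionOCT S′ oct)
  ... | S , minimal , S⊆ , |S|≤ =
    S , minimal , v∉projection S′ ∘ S⊆ , ≤-trans |S|≤ (length-projection S′)

  module _ (S : List (Fin n)) (v∉S : v ∉ S) where
    olds : List (V′ G v)
    olds = mapWith∈ S λ {u} u∈S → old u λ { refl → v∉S u∈S }

    map-project-olds : map project olds ≡ S
    map-project-olds = trans (map-mapWith∈ S _ project) (mapWith∈-id S)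

    length-olds : length olds ≡ length S
    length-olds = trans (sym (length-map project olds)) (cong length map-project-olds)

    olds-unique : Unique S → Unique olds
    olds-unique unique = Unique.map⁻ (subst Unique (sym map-project-olds) unique)

    ∈-olds⁺ : ∀ {u} (p : False (u ≟ v)) → u ∈ S → inj₁ (u , p) ∈ olds
    ∈-olds⁺ p u∈S = Any.mapWith∈⁺ _ (_ , u∈S , old-irrelevant p _)

    ∈-olds⁻ : ∀ {x} → x ∈ olds → ∃₂ λ u p → u ∈ S × x ≡ inj₁ (u , p)
    ∈-olds⁻ x∈ with Any.mapWith∈⁻ S _ x∈
    ... | u , u∈S , refl = u , _ , u∈S , refl

    project-∈-olds : ∀ {x} → x ∈ olds → project x ∈ S
    project-∈-olds x∈ with ∈-olds⁻ x∈
    ... | _ , _ , u∈S , refl = u∈S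

    project-injective-olds : ∀ {x y} → x ∈ olds → y ∈ olds → project x ≡ project y → x ≡ y
    project-injective-olds x∈ y∈ eq with ∈-olds⁻ x∈ | ∈-olds⁻ y∈
    ... | _ , p , _ , refl | _ , q , _ , refl with refl ← eq = old-irrelevant p q

    oldsOCT : IsOCTᶜ G S → IsOCT (G′ G v) olds
    oldsOCT (c , proper) = colour , colour-proper
      where
      colour : Σ (V′ G v) (_∉ olds) → Bool
      colour (inj₁ (u , _) , _) = c u
      colour (inj₂ _ , _)       = c v

      old≁new : ∀ {a i j} (p : False (a ≟ v)) (vij : i < j × Adj G v i × Adj G v j) →
        inj₁ (a , p) ∉ olds → Adj (G′ G v) (inj₁ (a , p)) (inj₂ ((i , j) , vij)) → c a ≢ c v
      old≁new p vij@(_ , vi , vj) a∉ aw with Equivalence.to (Adj-old-new p vij) aw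
      ... | inj₁ refl = proper v _ v∉S (a∉ ∘ ∈-olds⁺ p) vi ∘ sym
      ... | inj₂ refl = proper v _ v∉S (a∉ ∘ ∈-olds⁺ p) vj ∘ sym

      colour-proper : ∀ x y → Adj (G′ G v ─ olds) x y → colour x ≢ colour y
      colour-proper (inj₁ (a , p) , a∉) (inj₁ (b , q) , b∉) ab = proper a b (a∉ ∘ ∈-olds⁺ p) (b∉ ∘ ∈-olds⁺ q) ab
      colour-proper (inj₁ (a , p) , a∉) (inj₂ (_ , vij) , _) aw = old≁new p vij a∉ aw
      colour-proper (inj₂ (_ , vij) , _) (inj₁ (a , p) , a∉) wa = old≁new p vij a∉ wa ∘ sym
      colour-proper (inj₂ _ , _)         (inj₂ _ , _)         ()

    oldsMinimalOCT : IsMinimalOCT G S → IsMinimalOCT (G′ G v) olds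
    oldsMinimalOCT (unique , oct , minimal) =
      olds-unique unique , oldsOCT (IsOCT⇒IsOCTᶜ _≟_ G S oct) , minimal′
      where
      minimal′ : ∀ T′ → Unique T′ → T′ ⊆ olds → ¬ (olds ⊆ T′) → ¬ IsOCT (G′ G v) T′
      minimal′ T′ _ T′⊆olds olds⊈T′ octT′ =
        minimal (projection T′) (projection-unique T′) projection⊆S S⊈projection
                (IsOCTᶜ⇒IsOCT G (projectionOCT T′ octT′))
        where
        projection⊆S : projection T′ ⊆ S
        projection⊆S u∈ with ∈-projection⁻ T′ u∈
        ... | x , x∈T′ , refl = project-∈-olds (T′⊆olds x∈T′)

        olds⊆T′ : S ⊆ projection T′ → olds ⊆ T′
        olds⊆T′ S⊆ x∈ with ∈-projection⁻ T′ (S⊆ (project-∈-olds x∈))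
        ... | y , y∈T′ , px≡py =
          subst (_∈ T′) (project-injective-olds (T′⊆olds y∈T′) x∈ (sym px≡py)) y∈T′

        S⊈projection : ¬ (S ⊆ projection T′)
        S⊈projection = olds⊈T′ ∘ olds⊆T′

mainTheorem12 : ∀ {n : ℕ} (G : Graph (Fin n)) (v : Fin n) (k : ℕ) → 1 ≤ k →
    (Σ (List (Fin n)) (λ S → IsMinimalOCT G S × v ∉ S × length S ≤ k))
    ⇔ (Σ (List (V′ G v)) (λ S → IsMinimalOCT (G′ G v) S × length S ≤ k))
mainTheorem12 G v k _ = mk⇔
  (λ (S , minimal , v∉S , |S|≤k) →
     olds G v S v∉S , oldsMinimalOCT G v S v∉S minimal , subst (_≤ k) (sym (length-olds G v S v∉S)) |S|≤k)
  (λ (S′ , (_ , oct , _) , |S′|≤k) →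
     let (S , minimal , v∉S , |S|≤|S′|) = minimalOCT-within-projection G v S′ oct
     in  S , minimal , v∉S , ≤-trans |S|≤|S′| |S′|≤k)
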